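{- Let $c,s$ be positive integers and let $(\mathcal C,\mathcal S)$ be a minimal $(c,s)$-normal cover of a graph $G$ with $n$ vertices. Then $|\mathcal C|+|\mathcal S|\leq n+1$.
   Context: A $(c,s)$-normal cover of a graph $G$ is a pair $(\mathcal C,\mathcal S)$ where $\mathcal C$ is a set of cliques of size at most $c$ covering all vertices, $\mathcal S$ is a set of stable sets of size at most $s$ covering all vertices, and every clique in $\mathcal C$ meets every stable set in $\mathcal S$. The cover is minimal if no proper subset of $\mathcal C$ covers $V(G)$ and no proper subset of $\mathcal S$ covers $V(G)$. -}

module Defs where

open import Data.Nat using (ℕ; _≤_)
open import Data.Fin using (Fin)
open import Data.Fin.Subset using (Subset; _∈_; _∉_; _∩_; Nonempty; ∣_∣)
open import Data.List using (List; length)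
import Data.List.Membership.Propositional as LM
open import Data.List.Relation.Unary.Unique.Propositional using (Unique)
open import Data.Product using (Σ; ∃; _×_)
open import Relation.Nullary using (¬_)
open import Relation.Binary.PropositionalEquality using (_≡_)

record Graph (n : ℕ) : Set₁ where
  field
    Adj     : Fin n → Fin n → Set
    sym     : ∀ {u v} → Adj u v → Adj v u
    irrefl  : ∀ {u} → ¬ Adj u u
open Graph public

module _ {n : ℕ} (G : Graph n) where

  IsClique : Subset n → Set
  IsClique K = ∀ {u v} → u ∈ K → v ∈ K → ¬ u ≡ v → Adj G u v

  IsStable : Subset n → Set
  IsStable S = ∀ {u v} → u ∈ S → v ∈ S → ¬ Adj G u v

Covers : {n : ℕ} → List (Subset n) → Set
Covers {n} F = ∀ (v : Fin n) → ∃ λ X → X LM.∈ F × v ∈ X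

ProperSub : {n : ℕ} → List (Subset n) → List (Subset n) → Set
ProperSub F' F = (∀ {X} → X LM.∈ F' → X LM.∈ F) × (∃ λ X → X LM.∈ F × ¬ (X LM.∈ F'))

MinimalFamily : {n : ℕ} → List (Subset n) → Set
MinimalFamily F = ∀ F' → ProperSub F' F → ¬ Covers F'

record NormalCover {n : ℕ} (G : Graph n) (c s : ℕ)
                   (𝒞 𝒮 : List (Subset n)) : Set where
  field
    𝒞-unique  : Unique 𝒞
    𝒮-unique  : Unique 𝒮
    𝒞-clique  : ∀ {K} → K LM.∈ 𝒞 → IsClique G K × ∣ K ∣ ≤ c
    𝒮-stable  : ∀ {S} → S LM.∈ 𝒮 → IsStable G S × ∣ S ∣ ≤ s
    𝒞-covers  : Covers 𝒞
    𝒮-covers  : Covers 𝒮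
    meets     : ∀ {K S} → K LM.∈ 𝒞 → S LM.∈ 𝒮 → Nonempty (K ∩ S)

record MinimalNormalCover {n : ℕ} (G : Graph n) (c s : ℕ)
                          (𝒞 𝒮 : List (Subset n)) : Set where
  field
    normal    : NormalCover G c s 𝒞 𝒮
    𝒞-minimal : MinimalFamily 𝒞
    𝒮-minimal : MinimalFamily 𝒮

-- Proof by linear algebra over ℤ.  Index 𝒞 = (K₁,…,K_a) and 𝒮 = (S₁,…,S_b).
-- A clique and a stable set share at most one vertex, so every Kᵢ meets
-- every Sⱼ in exactly one vertex; minimality gives each member of either
-- family a private vertex.  Consider x ∈ ℤᵃ, y ∈ ℤᵇ with Σⱼ yⱼ = 0 and
-- Σᵢ xᵢ χ(Kᵢ) = Σⱼ yⱼ χ(Sⱼ) =: w, where χ is the incidence vector.  Then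
--   Σᵥ w(v)² = Σᵢ Σⱼ xᵢ yⱼ |Kᵢ ∩ Sⱼ| = (Σᵢ xᵢ)(Σⱼ yⱼ) = 0,
-- so w = 0, and evaluating at private vertices gives x = 0 and y = 0.  These
-- are n + 1 homogeneous equations in a + b unknowns with only the trivial
-- solution, hence a + b ≤ n + 1, since over ℤ a homogeneous system with more
-- unknowns than equations has a nonzero solution.
module Submission where

open import Defs hiding (sym)

open import Data.Nat as ℕ using (ℕ; zero; suc)
open import Data.Fin.Base using (Fin; zero; suc; punchIn; _↑ˡ_; _↑ʳ_)
open import Data.Vec.Functional using (Vector; replicate; _++_; insertAt; removeAt)
open import Data.Product using (_×_; _,_; proj₁; proj₂)
open import Data.Fin.Subset using (Subset)
open import Function using (_∘_)
open import Relation.Binary.PropositionalEquality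
  using (_≡_; _≢_; refl; sym; trans; cong; cong₂; subst; module ≡-Reasoning)

module FiniteSums where

  open import Data.Integer using (ℤ; +_; +0; +[1+_]; -[1+_]; 0ℤ; _+_; _*_; _≤_; +≤+)
  open import Data.Sum using (reduce)
  import Data.Integer.Properties as ℤₚ
  import Data.Nat.Properties as ℕₚ
  import Data.Fin.Properties as Finₚ
  import Data.Vec.Functional.Properties as Vecₚ
  open import Data.Integer.Tactic.RingSolver using (solve-∀)
  open import Algebra.Properties.Semiring.Sum ℤₚ.+-*-semiring public
    using (sum; sum-cong-≗; sum-remove; ∑-distrib-+; ∑-comm; *-distribˡ-sum; *-distribʳ-sum; sum-replicate-zero)
  open ≡-Reasoning

  infix 7 _·_

  _·_ : ∀ {k} → Vector ℤ k → Vector ℤ k → ℤ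
  u · x = sum (λ j → u j * x j)

  sum-zero : ∀ {k} {f : Vector ℤ k} → (∀ j → f j ≡ 0ℤ) → sum f ≡ 0ℤ
  sum-zero {k} f≗0 = trans (sum-cong-≗ f≗0) (sum-replicate-zero k)

  sum-single : ∀ {k} (f : Vector ℤ k) (p : Fin k) → (∀ j → j ≢ p → f j ≡ 0ℤ) → sum f ≡ f p
  sum-single {suc k} f p vanish = begin
    sum f                    ≡⟨ sum-remove f ⟩
    f p + sum (removeAt f p) ≡⟨ cong (_+_ (f p)) (sum-zero (λ j → vanish (punchIn p j) (Finₚ.punchInᵢ≢i p j))) ⟩
    f p + 0ℤ                 ≡⟨ ℤₚ.+-identityʳ (f p) ⟩
    f p                      ∎

  sum-split : ∀ a {b} (h : Vector ℤ (a ℕ.+ b)) →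
              sum h ≡ sum (h ∘ (_↑ˡ b)) + sum (h ∘ (a ↑ʳ_))
  sum-split zero    h = sym (ℤₚ.+-identityˡ (sum h))
  sum-split (suc a) h = trans (cong (_+_ (h zero)) (sum-split a (h ∘ suc)))
                              (sym (ℤₚ.+-assoc (h zero) _ _))

  sum-*-sum : ∀ {k l} (f : Vector ℤ k) (g : Vector ℤ l) →
              sum f * sum g ≡ sum (λ i → sum (λ j → f i * g j))
  sum-*-sum f g = trans (*-distribʳ-sum (sum g) f)
                        (sum-cong-≗ (λ i → *-distribˡ-sum (f i) g))

  ·-zeroˡ : ∀ {k} {u : Vector ℤ k} (x : Vector ℤ k) → (∀ j → u j ≡ 0ℤ) → u · x ≡ 0ℤ
  ·-zeroˡ x u≗0 = sum-zero (λ j → trans (cong (_* x j) (u≗0 j)) (ℤₚ.*-zeroˡ (x j)))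

  ·-scaleˡ : ∀ {k} (c : ℤ) (u x : Vector ℤ k) → (λ j → c * u j) · x ≡ c * (u · x)
  ·-scaleˡ c u x = trans (sum-cong-≗ (λ j → ℤₚ.*-assoc c (u j) (x j))) (sym (*-distribˡ-sum c (λ j → u j * x j)))

  ·-scaleʳ : ∀ {k} (u : Vector ℤ k) (c : ℤ) (x : Vector ℤ k) → u · (λ j → c * x j) ≡ c * (u · x)
  ·-scaleʳ u c x = trans (sum-cong-≗ (λ j → swap (u j) c (x j))) (sym (*-distribˡ-sum c (λ j → u j * x j)))
    where
    swap : ∀ a b d → a * (b * d) ≡ b * (a * d)
    swap = solve-∀

  ·-combineˡ : ∀ {k} (α β : ℤ) (u w x : Vector ℤ k) →
               (λ j → α * u j + β * w j) · x ≡ α * (u · x) + β * (w · x)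
  ·-combineˡ α β u w x = begin
    sum (λ j → (α * u j + β * w j) * x j)           ≡⟨ sum-cong-≗ (λ j → distrib α β (u j) (w j) (x j)) ⟩
    sum (λ j → α * (u j * x j) + β * (w j * x j))   ≡⟨ ∑-distrib-+ (λ j → α * (u j * x j)) (λ j → β * (w j * x j)) ⟩
    sum (λ j → α * (u j * x j)) + sum (λ j → β * (w j * x j))
      ≡⟨ cong₂ _+_ (sym (*-distribˡ-sum α (λ j → u j * x j))) (sym (*-distribˡ-sum β (λ j → w j * x j))) ⟩
    α * (u · x) + β * (w · x)                       ∎
    where
    distrib : ∀ α β a b d → (α * a + β * b) * d ≡ α * (a * d) + β * (b * d)
    distrib = solve-∀

  ·-insertAt : ∀ {k} (u : Vector ℤ (suc k)) (x : Vector ℤ k) (p : Fin (suc k)) (v : ℤ) →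
               u · insertAt x p v ≡ u p * v + removeAt u p · x
  ·-insertAt u x p v = trans (sum-remove (λ j → u j * insertAt x p v j))
    (cong₂ _+_ (cong (u p *_) (Vecₚ.insertAt-lookup x p v))
               (sum-cong-≗ (λ j → cong (u (punchIn p j) *_) (Vecₚ.insertAt-punchIn x p v j))))

  ·-++ : ∀ {a b} (f : Vector ℤ a) (g : Vector ℤ b) (z : Vector ℤ (a ℕ.+ b)) →
         (f ++ g) · z ≡ f · (z ∘ (_↑ˡ b)) + g · (z ∘ (a ↑ʳ_))
  ·-++ {a} {b} f g z = trans (sum-split a (λ j → (f ++ g) j * z j))
    (cong₂ _+_ (sum-cong-≗ (λ i → cong (_* z (i ↑ˡ b)) (Vecₚ.lookup-++ˡ f g i)))
               (sum-cong-≗ (λ j → cong (_* z (a ↑ʳ j)) (Vecₚ.lookup-++ʳ f g j))))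

  square-nonneg : ∀ i → + 0 ≤ i * i
  square-nonneg +0       = +≤+ ℕ.z≤n
  square-nonneg +[1+ n ] = +≤+ ℕ.z≤n
  square-nonneg -[1+ n ] = +≤+ ℕ.z≤n

  sum-nonneg : ∀ {k} (f : Vector ℤ k) → (∀ j → + 0 ≤ f j) → + 0 ≤ sum f
  sum-nonneg {zero}  f f≥0 = +≤+ ℕ.z≤n
  sum-nonneg {suc k} f f≥0 = ℤₚ.+-mono-≤ (f≥0 zero) (sum-nonneg (f ∘ suc) (f≥0 ∘ suc))

  nonneg-+-zero : ∀ {i j} → + 0 ≤ i → + 0 ≤ j → i + j ≡ 0ℤ → i ≡ 0ℤ × j ≡ 0ℤ
  nonneg-+-zero {+ m} {+ n} _ _ m+n≡0 =
    cong +_ (ℕₚ.m+n≡0⇒m≡0 m (ℤₚ.+-injective m+n≡0)) , cong +_ (ℕₚ.m+n≡0⇒n≡0 m (ℤₚ.+-injective m+n≡0))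

  nonneg-sum-zero : ∀ {k} (f : Vector ℤ k) → (∀ j → + 0 ≤ f j) → sum f ≡ 0ℤ → ∀ j → f j ≡ 0ℤ
  nonneg-sum-zero f f≥0 Σf≡0 zero    = proj₁ (nonneg-+-zero (f≥0 zero) (sum-nonneg (f ∘ suc) (f≥0 ∘ suc)) Σf≡0)
  nonneg-sum-zero f f≥0 Σf≡0 (suc j) = nonneg-sum-zero (f ∘ suc) (f≥0 ∘ suc)
    (proj₂ (nonneg-+-zero (f≥0 zero) (sum-nonneg (f ∘ suc) (f≥0 ∘ suc)) Σf≡0)) j

  sum-squares-zero : ∀ {k} (f : Vector ℤ k) → sum (λ j → f j * f j) ≡ 0ℤ → ∀ j → f j ≡ 0ℤ
  sum-squares-zero f Σf²≡0 j =
    reduce (ℤₚ.i*j≡0⇒i≡0∨j≡0 (f j) (nonneg-sum-zero _ (square-nonneg ∘ f) Σf²≡0 j))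

module HomogeneousSystems where

  open import Data.Integer using (ℤ; 0ℤ; 1ℤ; _+_; _*_; -_)
  import Data.Integer.Properties as ℤₚ
  import Data.Nat.Properties as ℕₚ
  import Data.Fin.Properties as Finₚ
  import Data.Vec.Functional.Properties as Vecₚ
  open import Data.Integer.Tactic.RingSolver using (solve-∀)
  open import Data.Product using (∃; _,_)
  open import Data.Sum using ([_,_])
  open import Relation.Nullary using (yes; no; ¬?)
  open import Relation.Nullary.Decidable using (decidable-stable)
  open FiniteSums
  open ≡-Reasoning

  NonZeroVector : ∀ {k} → Vector ℤ k → Set
  NonZeroVector x = ∃ λ j → x j ≢ 0ℤ

  Solves : ∀ {m k} → (Fin m → Vector ℤ k) → Vector ℤ k → Set
  Solves A x = ∀ i → A i · x ≡ 0ℤ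

  -- Eliminating the unknown p with the first equation, whose coefficient c
  -- at p is nonzero: every solution y of the reduced system in the other
  -- unknowns lifts to the solution  x = (c·y with -(r·y) inserted at p)
  -- of the original one.
  module Pivot {m k} (A : Fin (suc m) → Vector ℤ (suc k)) (p : Fin (suc k)) where

    c : ℤ
    c = A zero p

    r : Vector ℤ k
    r = removeAt (A zero) p

    reduced : Fin m → Vector ℤ k
    reduced i j = c * removeAt (A (suc i)) p j + (- A (suc i) p) * r j

    lift : Vector ℤ k → Vector ℤ (suc k)
    lift y = insertAt (λ j → c * y j) p (- (r · y))

    lift-solves : ∀ y → Solves reduced y → Solves A (lift y)
    lift-solves y _ zero = begin
      A zero · lift y                        ≡⟨ ·-insertAt (A zero) _ p _ ⟩
      c * (- (r · y)) + r · (λ j → c * y j)  ≡⟨ cong (_+_ (c * (- (r · y)))) (·-scaleʳ r c y) ⟩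
      c * (- (r · y)) + c * (r · y)          ≡⟨ cancel c (r · y) ⟩
      0ℤ                                     ∎
      where
      cancel : ∀ a b → a * (- b) + a * b ≡ 0ℤ
      cancel = solve-∀
    lift-solves y reduced-y (suc i) = begin
      u · lift y                                            ≡⟨ ·-insertAt u _ p _ ⟩
      u p * (- (r · y)) + removeAt u p · (λ j → c * y j)   ≡⟨ cong (_+_ (u p * (- (r · y)))) (·-scaleʳ (removeAt u p) c y) ⟩
      u p * (- (r · y)) + c * (removeAt u p · y)           ≡⟨ rearrange (u p) (r · y) c (removeAt u p · y) ⟩
      c * (removeAt u p · y) + (- u p) * (r · y)           ≡⟨ ·-combineˡ c (- u p) (removeAt u p) r y ⟨
      reduced i · y                                         ≡⟨ reduced-y i ⟩
      0ℤ                                                    ∎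
      where
      u = A (suc i)
      rearrange : ∀ a b d e → a * (- b) + d * e ≡ d * e + (- a) * b
      rearrange = solve-∀

    lift-nonzero : c ≢ 0ℤ → ∀ y → NonZeroVector y → NonZeroVector (lift y)
    lift-nonzero c≢0 y (j , yj≢0) = punchIn p j , λ liftj≡0 →
      [ c≢0 , yj≢0 ] (ℤₚ.i*j≡0⇒i≡0∨j≡0 c (trans (sym (Vecₚ.insertAt-punchIn _ p _ j)) liftj≡0))

  homogeneous-system : ∀ {m k} → m ℕ.< k → (A : Fin m → Vector ℤ k) →
                       ∃ λ x → NonZeroVector x × Solves A x
  homogeneous-system {zero} {suc k} _ A = (λ _ → 1ℤ) , (zero , λ ()) , λ ()
  homogeneous-system {suc m} {suc k} (ℕ.s≤s m<k) A
    with Finₚ.any? (λ p → ¬? (A zero p ℤₚ.≟ 0ℤ))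
  ... | yes (p , c≢0) =
    let (y , y≢0 , y-solves) = homogeneous-system m<k (Pivot.reduced A p)
    in Pivot.lift A p y , Pivot.lift-nonzero A p c≢0 y y≢0 , Pivot.lift-solves A p y y-solves
  ... | no no-pivot =
    let (x , x≢0 , x-solves) = homogeneous-system (ℕₚ.m<n⇒m<1+n m<k) (A ∘ suc)
        first-row-zero j = decidable-stable (A zero j ℤₚ.≟ 0ℤ) (λ Aj≢0 → no-pivot (j , Aj≢0))
    in x , x≢0 , λ { zero → ·-zeroˡ x first-row-zero ; (suc i) → x-solves i }

module PrivateElements where

  open import Data.Fin.Subset using (_∈_)
  import Data.Fin.Subset.Properties as Subsetₚ
  import Data.Fin.Properties as Finₚ
  open import Data.Bool.Properties using () renaming (_≟_ to _≟ᵇ_)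
  open import Data.Vec.Properties using (≡-dec)
  open import Data.List using (List; filter; lookup)
  import Data.List.Membership.Propositional as List
  open import Data.List.Membership.Propositional using (find; lose)
  open import Data.List.Membership.Propositional.Properties using (∈-filter⁺; ∈-filter⁻; ∈-lookup)
  open import Data.List.Relation.Unary.Any using (any?)
  open import Data.List.Relation.Unary.AllPairs.Core using (_∷_)
  import Data.List.Relation.Unary.All as All
  open import Data.List.Relation.Unary.Unique.Propositional using (Unique)
  open import Data.Product using (∃; _,_; proj₁; proj₂)
  open import Relation.Nullary using (¬_; Dec; ¬?)
  open import Relation.Nullary.Decidable using (decidable-stable)
  open import Relation.Nullary.Negation using (contradiction)

  _≟_ : ∀ {n} (X Y : Subset n) → Dec (X ≡ Y)
  _≟_ = ≡-dec _≟ᵇ_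

  -- Removing X from a minimal cover F leaves a vertex uncovered; it lies
  -- in X and in no other member of F.
  private-element : ∀ {n} {F : List (Subset n)} {X} → MinimalFamily F → Covers F → X List.∈ F →
                    ∃ λ v → v ∈ X × (∀ {Y} → Y List.∈ F → v ∈ Y → Y ≡ X)
  private-element {n} {F} {X} minimal covers X∈F = v , v∈X , only-X
    where
    other? = λ (Y : Subset n) → ¬? (Y ≟ X)
    F∖X = filter other? F

    F∖X⊂F : ProperSub F∖X F
    F∖X⊂F = (λ Y∈F∖X → proj₁ (∈-filter⁻ other? {xs = F} Y∈F∖X)) , X , X∈F ,
             λ X∈F∖X → proj₂ (∈-filter⁻ other? {xs = F} X∈F∖X) refl

    uncovered : ∃ λ v → ¬ ∃ λ Y → Y List.∈ F∖X × v ∈ Y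
    uncovered = let (v , v∉) = Finₚ.¬∀⟶∃¬ n _ (λ v → any? (v Subsetₚ.∈?_) F∖X)
                                  (λ all → minimal F∖X F∖X⊂F (λ v → find (all v)))
                in v , λ (Y , Y∈ , v∈Y) → v∉ (lose Y∈ v∈Y)

    v = proj₁ uncovered

    only-X : ∀ {Y} → Y List.∈ F → v ∈ Y → Y ≡ X
    only-X {Y} Y∈F v∈Y = decidable-stable (Y ≟ X)
      (λ Y≢X → proj₂ uncovered (Y , ∈-filter⁺ other? Y∈F Y≢X , v∈Y))

    v∈X : v ∈ X
    v∈X = let (Y , Y∈F , v∈Y) = covers v in subst (v ∈_) (only-X Y∈F v∈Y) v∈Y

  lookup-injective : ∀ {A : Set} {xs : List A} → Unique xs → ∀ {i j} → lookup xs i ≡ lookup xs j → i ≡ j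
  lookup-injective (_ ∷ _)      {zero}  {zero}  _ = refl
  lookup-injective (x∉xs ∷ _)   {zero}  {suc j} e = contradiction e (All.lookup x∉xs (∈-lookup j))
  lookup-injective (x∉xs ∷ _)   {suc i} {zero}  e = contradiction (sym e) (All.lookup x∉xs (∈-lookup i))
  lookup-injective (_ ∷ unique) {suc i} {suc j} e = cong suc (lookup-injective unique e)

  HasPrivateVertices : ∀ {n k} → (Fin k → Subset n) → Set
  HasPrivateVertices F = ∀ i → ∃ λ v → v ∈ F i × (∀ i′ → v ∈ F i′ → i′ ≡ i)

  private-vertex : ∀ {n} {F : List (Subset n)} → Unique F → MinimalFamily F → Covers F →
                   HasPrivateVertices (lookup F)
  private-vertex unique minimal covers i =
    let (v , v∈Fi , only-Fi) = private-element minimal covers (∈-lookup i)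
    in v , v∈Fi , λ i′ v∈Fi′ → lookup-injective unique (only-Fi (∈-lookup i′) v∈Fi′)

module Incidence {n : ℕ} where

  open import Data.Fin.Subset using (_∈_; _∉_; _∩_; Nonempty)
  import Data.Fin.Subset.Properties as Subsetₚ
  open import Data.Integer using (ℤ; 0ℤ; 1ℤ; _*_)
  import Data.Integer.Properties as ℤₚ
  open import Data.Product using (_,_; proj₁; proj₂)
  open import Data.Integer.Tactic.RingSolver using (solve-∀)
  open import Relation.Nullary using (¬_; yes; no)
  open import Relation.Nullary.Negation using (contradiction)
  open FiniteSums
  open ≡-Reasoning

  χ : Subset n → Vector ℤ n
  χ X v with v Subsetₚ.∈? X
  ... | yes _ = 1ℤ
  ... | no  _ = 0ℤ

  χ-∈ : ∀ {X v} → v ∈ X → χ X v ≡ 1ℤ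
  χ-∈ {X} {v} v∈X with v Subsetₚ.∈? X
  ... | yes _   = refl
  ... | no  v∉X = contradiction v∈X v∉X

  χ-∉ : ∀ {X v} → v ∉ X → χ X v ≡ 0ℤ
  χ-∉ {X} {v} v∉X with v Subsetₚ.∈? X
  ... | yes v∈X = contradiction v∈X v∉X
  ... | no  _   = refl

  χ-product-zero : ∀ X Y v → ¬ (v ∈ X × v ∈ Y) → χ X v * χ Y v ≡ 0ℤ
  χ-product-zero X Y v not-both with v Subsetₚ.∈? X | v Subsetₚ.∈? Y
  ... | yes v∈X | yes v∈Y = contradiction (v∈X , v∈Y) not-both
  ... | yes _   | no  _   = refl
  ... | no  _   | _       = refl

  common-vertices : Subset n → Subset n → ℤ
  common-vertices X Y = χ X · χ Y

  -- A clique and a stable set share at most one vertex, so if they meet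
  -- they overlap in exactly one.
  clique-stable-meet-once : ∀ (G : Graph n) {K S} → IsClique G K → IsStable G S →
                            Nonempty (K ∩ S) → common-vertices K S ≡ 1ℤ
  clique-stable-meet-once G {K} {S} clique stable (u , u∈K∩S) =
    trans (sum-single _ u only-u) (cong₂ _*_ (χ-∈ u∈K) (χ-∈ u∈S))
    where
    u∈K = proj₁ (Subsetₚ.x∈p∩q⁻ K S u∈K∩S)
    u∈S = proj₂ (Subsetₚ.x∈p∩q⁻ K S u∈K∩S)
    only-u : ∀ v → v ≢ u → χ K v * χ S v ≡ 0ℤ
    only-u v v≢u = χ-product-zero K S v λ (v∈K , v∈S) →
      stable u∈S v∈S (clique u∈K v∈K λ u≡v → v≢u (sym u≡v))

  combination : ∀ {k} → (Fin k → Subset n) → Vector ℤ k → Vector ℤ n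
  combination F x v = (λ i → χ (F i) v) · x

  combination-private : ∀ {k} (F : Fin k → Subset n) (x : Vector ℤ k) {i v} →
                        v ∈ F i → (∀ i′ → v ∈ F i′ → i′ ≡ i) → combination F x v ≡ x i
  combination-private F x {i} {v} v∈Fi only-Fi = begin
    combination F x v ≡⟨ sum-single _ i (λ i′ i′≢i → trans (cong (_* x i′) (χ-∉ (λ v∈Fi′ → i′≢i (only-Fi i′ v∈Fi′))))
                                                            (ℤₚ.*-zeroˡ (x i′))) ⟩
    χ (F i) v * x i   ≡⟨ cong (_* x i) (χ-∈ v∈Fi) ⟩
    1ℤ * x i          ≡⟨ ℤₚ.*-identityˡ (x i) ⟩
    x i               ∎

  combination-product : ∀ {a b} (K : Fin a → Subset n) (S : Fin b → Subset n) →
    (∀ i j → common-vertices (K i) (S j) ≡ 1ℤ) → ∀ x y →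
    sum (λ v → combination K x v * combination S y v) ≡ sum x * sum y
  combination-product K S single x y = begin
    sum (λ v → combination K x v * combination S y v)
      ≡⟨ sum-cong-≗ (λ v → sum-*-sum (λ i → χ (K i) v * x i) (λ j → χ (S j) v * y j)) ⟩
    sum (λ v → sum (λ i → sum (λ j → (χ (K i) v * x i) * (χ (S j) v * y j))))
      ≡⟨ ∑-comm (λ v i → sum (λ j → (χ (K i) v * x i) * (χ (S j) v * y j))) ⟩
    sum (λ i → sum (λ v → sum (λ j → (χ (K i) v * x i) * (χ (S j) v * y j))))
      ≡⟨ sum-cong-≗ (λ i → ∑-comm (λ v j → (χ (K i) v * x i) * (χ (S j) v * y j))) ⟩
    sum (λ i → sum (λ j → sum (λ v → (χ (K i) v * x i) * (χ (S j) v * y j))))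
      ≡⟨ sum-cong-≗ (λ i → sum-cong-≗ (λ j → pair i j)) ⟩
    sum (λ i → sum (λ j → x i * y j))
      ≡⟨ sum-*-sum x y ⟨
    sum x * sum y ∎
    where
    regroup : ∀ a b c d → (a * b) * (c * d) ≡ (a * c) * (b * d)
    regroup = solve-∀
    pair : ∀ i j → sum (λ v → (χ (K i) v * x i) * (χ (S j) v * y j)) ≡ x i * y j
    pair i j = begin
      sum (λ v → (χ (K i) v * x i) * (χ (S j) v * y j))
        ≡⟨ sum-cong-≗ (λ v → regroup (χ (K i) v) (x i) (χ (S j) v) (y j)) ⟩
      sum (λ v → (χ (K i) v * χ (S j) v) * (x i * y j))
        ≡⟨ *-distribʳ-sum (x i * y j) (λ v → χ (K i) v * χ (S j) v) ⟨
      common-vertices (K i) (S j) * (x i * y j)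
        ≡⟨ cong (_* (x i * y j)) (single i j) ⟩
      1ℤ * (x i * y j)
        ≡⟨ ℤₚ.*-identityˡ (x i * y j) ⟩
      x i * y j ∎

  -- Hence a combination of the Kᵢ that equals a combination of the Sⱼ with
  -- zero coefficient sum is the zero vector: its sum of squares is 0.
  balanced-combination-zero : ∀ {a b} (K : Fin a → Subset n) (S : Fin b → Subset n) →
    (∀ i j → common-vertices (K i) (S j) ≡ 1ℤ) → ∀ x y →
    (∀ v → combination K x v ≡ combination S y v) → sum y ≡ 0ℤ →
    ∀ v → combination K x v ≡ 0ℤ
  balanced-combination-zero K S single x y K≗S Σy≡0 = sum-squares-zero (combination K x) (begin
    sum (λ v → combination K x v * combination K x v)
      ≡⟨ sum-cong-≗ (λ v → cong (combination K x v *_) (K≗S v)) ⟩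
    sum (λ v → combination K x v * combination S y v)
      ≡⟨ combination-product K S single x y ⟩
    sum x * sum y
      ≡⟨ cong (sum x *_) Σy≡0 ⟩
    sum x * 0ℤ
      ≡⟨ ℤₚ.*-zeroʳ (sum x) ⟩
    0ℤ ∎)

-- The equations of the main argument: unknowns x ∈ ℤᵃ, y ∈ ℤᵇ (stored as
-- one vector x ++ y) subject to Σⱼ yⱼ = 0 and Σᵢ xᵢ χ(Kᵢ) = Σⱼ yⱼ χ(Sⱼ)
-- coordinatewise; n + 1 equations in a + b unknowns.
module CoverSystem {n a b : ℕ} (K : Fin a → Subset n) (S : Fin b → Subset n) where

  open import Data.Integer using (ℤ; 0ℤ; 1ℤ; -1ℤ; _+_; _-_; _*_)
  import Data.Integer.Properties as ℤₚ
  import Data.Nat.Properties as ℕₚ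
  import Data.Fin.Properties as Finₚ
  open import Data.Fin.Base using (splitAt)
  open import Data.Sum using (inj₁; inj₂)
  open import Data.Product using (_,_)
  open FiniteSums
  open HomogeneousSystems
  open PrivateElements using (HasPrivateVertices)
  open Incidence
  open ≡-Reasoning

  system : Fin (suc n) → Vector ℤ (a ℕ.+ b)
  system zero    = replicate a 0ℤ ++ replicate b 1ℤ
  system (suc v) = (λ i → χ (K i) v) ++ (λ j → -1ℤ * χ (S j) v)

  module Solution (z : Vector ℤ (a ℕ.+ b)) (z-solves : Solves system z) where

    x : Vector ℤ a
    x = z ∘ (_↑ˡ b)

    y : Vector ℤ b
    y = z ∘ (a ↑ʳ_)

    y-sum-zero : sum y ≡ 0ℤ
    y-sum-zero = begin
      sum y                                    ≡⟨ sum-cong-≗ (λ j → sym (ℤₚ.*-identityˡ (y j))) ⟩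
      replicate b 1ℤ · y                       ≡⟨ ℤₚ.+-identityˡ _ ⟨
      0ℤ + replicate b 1ℤ · y                  ≡⟨ cong (_+ replicate b 1ℤ · y) (·-zeroˡ x (λ _ → refl)) ⟨
      replicate a 0ℤ · x + replicate b 1ℤ · y  ≡⟨ ·-++ (replicate a 0ℤ) (replicate b 1ℤ) z ⟨
      system zero · z                          ≡⟨ z-solves zero ⟩
      0ℤ                                       ∎

    combinations-agree : ∀ v → combination K x v ≡ combination S y v
    combinations-agree v = ℤₚ.i-j≡0⇒i≡j _ _ (begin
      combination K x v - combination S y v
        ≡⟨ cong (_+_ (combination K x v)) (ℤₚ.-1*i≡-i (combination S y v)) ⟨
      combination K x v + -1ℤ * combination S y v
        ≡⟨ cong (_+_ (combination K x v)) (·-scaleˡ -1ℤ (λ j → χ (S j) v) y) ⟨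
      combination K x v + (λ j → -1ℤ * χ (S j) v) · y
        ≡⟨ ·-++ (λ i → χ (K i) v) (λ j → -1ℤ * χ (S j) v) z ⟨
      system (suc v) · z
        ≡⟨ z-solves (suc v) ⟩
      0ℤ ∎)

  blocks-zero : ∀ (z : Vector ℤ (a ℕ.+ b)) → (∀ i → z (i ↑ˡ b) ≡ 0ℤ) → (∀ j → z (a ↑ʳ j) ≡ 0ℤ) →
                ∀ k → z k ≡ 0ℤ
  blocks-zero z left right k with splitAt a k in eq
  ... | inj₁ i = subst (λ t → z t ≡ 0ℤ) (Finₚ.splitAt⁻¹-↑ˡ eq) (left i)
  ... | inj₂ j = subst (λ t → z t ≡ 0ℤ) (Finₚ.splitAt⁻¹-↑ʳ eq) (right j)

  only-trivial-solution : (∀ i j → common-vertices (K i) (S j) ≡ 1ℤ) →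
    HasPrivateVertices K → HasPrivateVertices S →
    ∀ z → Solves system z → ∀ k → z k ≡ 0ℤ
  only-trivial-solution single K-private S-private z z-solves = blocks-zero z x-zero y-zero
    where
    open Solution z z-solves
    K-combination-zero : ∀ v → combination K x v ≡ 0ℤ
    K-combination-zero = balanced-combination-zero K S single x y combinations-agree y-sum-zero
    x-zero : ∀ i → x i ≡ 0ℤ
    x-zero i = let (v , v∈Ki , only-Ki) = K-private i in
      trans (sym (combination-private K x v∈Ki only-Ki)) (K-combination-zero v)
    y-zero : ∀ j → y j ≡ 0ℤ
    y-zero j = let (v , v∈Sj , only-Sj) = S-private j in
      trans (sym (combination-private S y v∈Sj only-Sj))
            (trans (sym (combinations-agree v)) (K-combination-zero v))

  family-size-bound : (∀ i j → common-vertices (K i) (S j) ≡ 1ℤ) →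
    HasPrivateVertices K → HasPrivateVertices S → a ℕ.+ b ℕ.≤ suc n
  family-size-bound single K-private S-private = ℕₚ.≮⇒≥ λ n+1<a+b →
    let (z , (k , zk≢0) , z-solves) = homogeneous-system n+1<a+b system
    in zk≢0 (only-trivial-solution single K-private S-private z z-solves k)

open import Data.Nat using (ℕ; _≤_; _+_; _>_)
open import Data.List using (List; length; lookup)
open import Data.List.Membership.Propositional.Properties using (∈-lookup)
import Data.Nat.Properties as ℕₚ
open import Data.Integer using (1ℤ)
open PrivateElements using (private-vertex)
open Incidence using (common-vertices; clique-stable-meet-once)

normal-cover-meet-once : ∀ {n c s} {G : Graph n} {𝒞 𝒮 : List (Subset n)} → NormalCover G c s 𝒞 𝒮 →
  ∀ i j → common-vertices (lookup 𝒞 i) (lookup 𝒮 j) ≡ 1ℤ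
normal-cover-meet-once {G = G} normal i j =
  clique-stable-meet-once G (proj₁ (𝒞-clique (∈-lookup i))) (proj₁ (𝒮-stable (∈-lookup j)))
                            (meets (∈-lookup i) (∈-lookup j))
  where open NormalCover normal

lemma4 : (c s n : ℕ) → c > 0 → s > 0 → (G : Graph n)
    → (𝒞 𝒮 : List (Subset n)) → MinimalNormalCover G c s 𝒞 𝒮
    → length 𝒞 + length 𝒮 ≤ n + 1
lemma4 c s n _ _ G 𝒞 𝒮 minimal-cover =
  subst (length 𝒞 + length 𝒮 ≤_) (ℕₚ.+-comm 1 n)
    (CoverSystem.family-size-bound (lookup 𝒞) (lookup 𝒮)
      (normal-cover-meet-once normal)
      (private-vertex 𝒞-unique 𝒞-minimal 𝒞-covers)
      (private-vertex 𝒮-unique 𝒮-minimal 𝒮-covers))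
  where
  open MinimalNormalCover minimal-cover
  open NormalCover normal
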